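{- Fix integers $s\geq r\geq 3$ and $\ell\geq 2$. Then there exists a constant $c(s,r,\ell)$ such that for all sufficiently large $n$, $$\mathrm{ex}_r(n,K_s^{(r)},S_\ell^r)\leq c(s,r,\ell)\,n^{r-2}.$$ Moreover, if $s\leq \ell+r-2$, then $\mathrm{ex}_r(n,K_s^{(r)},S_\ell^r)=\Theta(n^{r-2})$.
   Context: An $r$-graph is a hypergraph all of whose hyperedges have exactly $r$ vertices. $K_s^{(r)}$ is the complete $r$-graph on $s$ vertices. $S_\ell$ is the star with $\ell$ edges. For a graph $F$, the $r$-expansion $F^r$ is obtained from $F$ by adding $r-2$ new vertices to each edge, all new vertices distinct from each other and from $V(F)$. $\mathrm{ex}_r(n,\mathcal{H},\mathcal{F})$ is the maximum number of copies of $\mathcal{H}$ in an $n$-vertex $r$-graph containing no copy of $\mathcal{F}$. -}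

module Defs where

open import Data.Bool using (Bool; true; false; _∧_; _∨_; not)
open import Data.Nat using (ℕ; zero; suc; _∸_; _≡ᵇ_)
open import Data.Fin using (Fin)
open import Data.Fin.Subset using (Subset; inside; outside; ∣_∣; ⁅_⁆; _∪_; ⋃)
open import Data.Vec using (Vec; []; _∷_)
open import Data.List using (List; [_]; _++_; map; length; filterᵇ; foldr; allFin)
open import Data.Unit using (⊤; tt)
open import Data.Sum using (_⊎_; inj₁; inj₂)
open import Data.Product using (_×_; _,_; ∃)
open import Relation.Binary.PropositionalEquality using (_≡_)
open import Relation.Nullary using (¬_)
open import Function.Definitions using (Injective)

record RGraph (r n : ℕ) : Set where
  field
    edge    : Subset n → Bool
    uniform : ∀ e → edge e ≡ true → ∣ e ∣ ≡ r
open RGraph public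

allSubsets : ∀ n → List (Subset n)
allSubsets zero    = [ [] ]
allSubsets (suc n) = map (outside ∷_) (allSubsets n) ++ map (inside ∷_) (allSubsets n)

allᵇ : ∀ {A : Set} → (A → Bool) → List A → Bool
allᵇ p = foldr (λ x b → p x ∧ b) true

_⊆ᵇ_ : ∀ {n} → Subset n → Subset n → Bool
[] ⊆ᵇ [] = true
(x ∷ xs) ⊆ᵇ (y ∷ ys) = (not x ∨ y) ∧ (xs ⊆ᵇ ys)

isKsᵇ : ∀ {r n} (s : ℕ) → RGraph r n → Subset n → Bool
isKsᵇ {r} {n} s H S =
  (∣ S ∣ ≡ᵇ s) ∧ allᵇ (λ e → not ((e ⊆ᵇ S) ∧ (∣ e ∣ ≡ᵇ r)) ∨ edge H e) (allSubsets n)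

#Ks : ∀ {r n} (s : ℕ) → RGraph r n → ℕ
#Ks {r} {n} s H = length (filterᵇ (isKsᵇ s H) (allSubsets n))

-- The r-expansion S_ℓ^r of the star S_ℓ.  Vertices: the centre (inj₁ tt),
-- and for each edge i of the star, r-1 further vertices (inj₂ (i , j)):
-- j = 0 is the leaf, the other r-2 are the new expansion vertices.
StarV : (ℓ r : ℕ) → Set
StarV ℓ r = ⊤ ⊎ (Fin ℓ × Fin (r ∸ 1))

starEdgeImage : ∀ {ℓ r n} → (StarV ℓ r → Fin n) → Fin ℓ → Subset n
starEdgeImage {ℓ} {r} f i =
  ⁅ f (inj₁ tt) ⁆ ∪ ⋃ (map (λ j → ⁅ f (inj₂ (i , j)) ⁆) (allFin (r ∸ 1)))

ContainsStarExp : ∀ {r n} (ℓ : ℕ) → RGraph r n → Set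
ContainsStarExp {r} {n} ℓ H =
  ∃ λ (f : StarV ℓ r → Fin n) →
    Injective _≡_ _≡_ f × (∀ i → edge H (starEdgeImage {ℓ} {r} f i) ≡ true)

StarExpFree : ∀ {r n} (ℓ : ℕ) → RGraph r n → Set
StarExpFree ℓ H = ¬ ContainsStarExp ℓ H

{-# OPTIONS --safe #-}
module Submission where

-- If H contains no expanded star S_ℓ^r, then at every vertex v a family of
-- edges through v pairwise meeting only in v (a sunflower) has fewer than ℓ petals, so a
-- maximal one has a union τ v of at most ℓ r vertices that meets every edge through v
-- outside v.  Put cl A = A ∪ ⋃_{a ∈ A} τ a.  A copy S of K_s^(r) lies in cl E for one of
-- its edges E: for v ∈ S, fewer than r vertices of S avoid τ v - v, since r of them
-- including v would form an edge through v missing τ v - v.  Following τ twice inside E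
-- gives E ⊆ cl (cl G) for some G ⊆ E with r - 2 vertices.  Hence S ⊆ cl³ G, which leaves
-- at most C(n, r - 2) · 2^((r-2)(1+ℓr)³) copies of K_s^(r).
--
-- Fix a set A of t = s - r + 2 ≤ ℓ vertices and take as edges all r-sets
-- meeting A at least twice.  The petals of an expanded star would provide ℓ distinct
-- non-centre vertices in A and one further vertex of A, so there is none; and every s-set
-- containing A spans a K_s^(r), giving C(n - t, r - 2) = Ω(n^(r-2)) copies.

open import Defs
open import Data.Bool using (Bool; true; false; T; not; _∧_; _∨_)
import Data.Bool.Properties as Bool
open import Data.Bool.Properties using (T-∧; T-not-≡; T-≡)
open import Data.Empty using (⊥-elim)
open import Data.Fin using (Fin; zero; suc)
import Data.Fin.Properties as Fin
open import Data.Fin.Subset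
  using (Subset; inside; outside; _∈_; _∉_; _⊆_; ∣_∣; ⊥; ⊤; ⁅_⁆; _∪_; _∩_; _─_; _-_; ⋃; Nonempty; Empty)
open import Data.Fin.Subset.Properties
  using ( _∈?_; nonempty?; anySubset?; ∉⊥; ∈⊤; ⊥⊆; x∈⁅x⁆; x∈⁅y⁆⇒x≡y; x∉⁅y⁆⇒x≢y
        ; ⊆-refl; ⊆-trans; ⊆-antisym; drop-∷-⊆; out⊆; in⊆in
        ; x∈p∪q⁻; x∈p∪q⁺; x∈p∩q⁻; x∈p∩q⁺; x∈p∧x≢y⇒x∈p-y; x∈p∧x∉q⇒x∈p─q; p─⊥≡p; p─q⊆p
        ; ∣⊥∣≡0; ∣⊤∣≡n; ∣⁅x⁆∣≡1; ∣p∩q∣≤∣q∣; p⊆q⇒∣p∣≤∣q∣ )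
open import Data.List using (List; []; _∷_; _++_; map; length; filterᵇ; allFin)
open import Data.Nat.ListAction using (sum)
open import Data.List.Properties using (filter-++; length-++)
open import Data.List.Membership.Propositional using (lose) renaming (_∈_ to _∈ₗ_)
open import Data.List.Membership.Propositional.Properties using (∈-++⁺ˡ; ∈-++⁺ʳ; ∈-map⁺; ∈-filter⁺; ∈-allFin)
open import Data.List.Relation.Unary.All as All using (All; []; _∷_; lookup; universal)
open import Data.List.Relation.Unary.All.Properties using (all-filter)
open import Data.List.Relation.Unary.Any using (Any; here; there; satisfied)
import Data.List.Relation.Unary.Any.Properties as Any
open import Data.Nat using (NonZero; ℕ; zero; suc; _+_; _*_; _^_; _∸_; _≤_; _<_; z≤n; s≤s; _≡ᵇ_; _≤ᵇ_; _≤?_)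
open import Data.Nat.Combinatorics using (_C_; nCk+nC[k+1]≡[n+1]C[k+1])
open import Data.Nat.Properties
open import Data.Nat.DivMod using (_/_; m≡m%n+[m/n]*n; m%n<n; m/n*n≤m; m*n/n≡m; /-monoˡ-≤)
open import Algebra.Properties.CommutativeSemigroup *-commutativeSemigroup
  using () renaming (interchange to *-interchange)
open import Data.Product using (Σ; _×_; _,_; ∃; proj₁; proj₂)
open import Data.Sum using (_⊎_; inj₁; inj₂)
open import Data.Unit using (tt)
open import Data.Vec using ([]; _∷_; here; there)
open import Data.Vec.Functional using () renaming (_∷_ to _◂_)
open import Function using (_∘_; flip; _⇔_; mk⇔; Equivalence; case_of_)
open import Function.Definitions using (Injective)
open import Relation.Binary.PropositionalEquality
open import Relation.Nullary using (¬_; yes; no)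
open import Relation.Nullary.Decidable using (T?; ¬?; _×-dec_)

private
  variable
    A B : Set

-- Counting

countᵇ : (A → Bool) → List A → ℕ
countᵇ p xs = length (filterᵇ p xs)

countᵇ-++ : ∀ (p : A → Bool) xs ys → countᵇ p (xs ++ ys) ≡ countᵇ p xs + countᵇ p ys
countᵇ-++ p xs ys = trans (cong length (filter-++ (T? ∘ p) xs ys)) (length-++ (filterᵇ p xs))

countᵇ-map : ∀ (p : A → Bool) (f : B → A) xs → countᵇ p (map f xs) ≡ countᵇ (p ∘ f) xs
countᵇ-map p f [] = refl
countᵇ-map p f (x ∷ xs) with p (f x)
... | true  = cong suc (countᵇ-map p f xs)
... | false = countᵇ-map p f xs

countᵇ-none : ∀ (p : A → Bool) → (∀ x → ¬ T (p x)) → ∀ xs → countᵇ p xs ≡ 0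
countᵇ-none p none [] = refl
countᵇ-none p none (x ∷ xs) with p x in px
... | true  = ⊥-elim (none x (subst T (sym px) _))
... | false = countᵇ-none p none xs

countᵇ-mono : ∀ (p q : A → Bool) → (∀ x → T (p x) → T (q x)) → ∀ xs → countᵇ p xs ≤ countᵇ q xs
countᵇ-mono p q p⇒q [] = z≤n
countᵇ-mono p q p⇒q (x ∷ xs) with p x in px | q x in qx
... | true  | true  = s≤s (countᵇ-mono p q p⇒q xs)
... | false | true  = m≤n⇒m≤1+n (countᵇ-mono p q p⇒q xs)
... | false | false = countᵇ-mono p q p⇒q xs
... | true  | false = ⊥-elim (subst T qx (p⇒q x (subst T (sym px) _)))

countᵇ-∨ : ∀ (p q : A → Bool) xs → countᵇ (λ x → p x ∨ q x) xs ≤ countᵇ p xs + countᵇ q xs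
countᵇ-∨ p q [] = z≤n
countᵇ-∨ p q (x ∷ xs) with p x | q x
... | true  | true  = s≤s (≤-trans (countᵇ-∨ p q xs) (+-monoʳ-≤ _ (n≤1+n _)))
... | true  | false = s≤s (countᵇ-∨ p q xs)
... | false | true  = ≤-trans (s≤s (countᵇ-∨ p q xs)) (≤-reflexive (sym (+-suc _ _)))
... | false | false = countᵇ-∨ p q xs

union-bound : ∀ (p : A → Bool) (q : B → A → Bool) Gs →
  (∀ x → T (p x) → Any (λ G → T (q G x)) Gs) →
  ∀ xs → countᵇ p xs ≤ sum (map (λ G → countᵇ (q G) xs) Gs)
union-bound p q [] cover xs = ≤-reflexive (countᵇ-none p (λ x px → case cover x px of λ ()) xs)
union-bound {A = A} p q (G ∷ Gs) cover xs = begin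
  countᵇ p xs                                       ≤⟨ countᵇ-mono p _ split xs ⟩
  countᵇ (λ x → q G x ∨ rest x) xs                  ≤⟨ countᵇ-∨ (q G) rest xs ⟩
  countᵇ (q G) xs + countᵇ rest xs                  ≤⟨ +-monoʳ-≤ _ (union-bound rest q Gs cover-rest xs) ⟩
  countᵇ (q G) xs + sum (map (λ G → countᵇ (q G) xs) Gs) ∎
  where
  open ≤-Reasoning
  rest : A → Bool
  rest x = p x ∧ not (q G x)
  split : ∀ x → T (p x) → T (q G x ∨ rest x)
  split x px with q G x
  ... | true  = _
  ... | false = Equivalence.from T-∧ (px , _)
  cover-rest : ∀ x → T (rest x) → Any (λ G → T (q G x)) Gs
  cover-rest x h with Equivalence.to T-∧ h | cover x (proj₁ (Equivalence.to T-∧ h))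
  ... | _ , ¬qGx | here qGx = ⊥-elim (subst T (Equivalence.to T-not-≡ ¬qGx) qGx)
  ... | _ , _    | there a  = a

sum-map-≤ : ∀ (f : A → ℕ) c {xs} → All (λ x → f x ≤ c) xs → sum (map f xs) ≤ length xs * c
sum-map-≤ f c []         = z≤n
sum-map-≤ f c (fx≤c ∷ h) = +-mono-≤ fx≤c (sum-map-≤ f c h)

∈-allSubsets : ∀ {n} (X : Subset n) → X ∈ₗ allSubsets n
∈-allSubsets []            = here refl
∈-allSubsets (outside ∷ X) = ∈-++⁺ˡ (∈-map⁺ (outside ∷_) (∈-allSubsets X))
∈-allSubsets (inside ∷ X)  = ∈-++⁺ʳ _ (∈-map⁺ (inside ∷_) (∈-allSubsets X))

countSubsets : ∀ n → (Subset n → Bool) → ℕ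
countSubsets n p = countᵇ p (allSubsets n)

countSubsets-suc : ∀ n (p : Subset (suc n) → Bool) →
  countSubsets (suc n) p ≡ countSubsets n (p ∘ (outside ∷_)) + countSubsets n (p ∘ (inside ∷_))
countSubsets-suc n p = trans (countᵇ-++ p (map (outside ∷_) (allSubsets n)) _)
  (cong₂ _+_ (countᵇ-map p (outside ∷_) (allSubsets n)) (countᵇ-map p (inside ∷_) (allSubsets n)))

countSubsets-false : ∀ n → countSubsets n (λ _ → false) ≡ 0
countSubsets-false n = countᵇ-none _ (λ _ ()) (allSubsets n)

⊆ᵇ⇒⊆ : ∀ {n} {X Y : Subset n} → T (X ⊆ᵇ Y) → X ⊆ Y
⊆ᵇ⇒⊆ {X = []}          {[]}          _ ()
⊆ᵇ⇒⊆ {X = outside ∷ X} {_ ∷ Y}       h = out⊆ (⊆ᵇ⇒⊆ h)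
⊆ᵇ⇒⊆ {X = inside ∷ X}  {inside ∷ Y}  h = in⊆in (⊆ᵇ⇒⊆ h)

⊆⇒⊆ᵇ : ∀ {n} {X Y : Subset n} → X ⊆ Y → T (X ⊆ᵇ Y)
⊆⇒⊆ᵇ {X = []}          {[]}          _ = _
⊆⇒⊆ᵇ {X = outside ∷ X} {_ ∷ Y}       h = ⊆⇒⊆ᵇ (drop-∷-⊆ h)
⊆⇒⊆ᵇ {X = inside ∷ X}  {inside ∷ Y}  h = ⊆⇒⊆ᵇ (drop-∷-⊆ h)
⊆⇒⊆ᵇ {X = inside ∷ X}  {outside ∷ Y} h = case h here of λ ()

countSubsets-⊆ : ∀ {n} (A : Subset n) → countSubsets n (_⊆ᵇ A) ≡ 2 ^ ∣ A ∣
countSubsets-⊆ [] = refl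
countSubsets-⊆ (inside ∷ A) =
  trans (countSubsets-suc _ (_⊆ᵇ (inside ∷ A)))
        (cong₂ _+_ (countSubsets-⊆ A) (trans (countSubsets-⊆ A) (sym (+-identityʳ _))))
countSubsets-⊆ {suc n} (outside ∷ A) =
  trans (countSubsets-suc n (_⊆ᵇ (outside ∷ A)))
        (trans (cong₂ _+_ (countSubsets-⊆ A) (countSubsets-false n)) (+-identityʳ _))

countSubsets-size : ∀ n k → countSubsets n (λ X → ∣ X ∣ ≡ᵇ k) ≡ n C k
countSubsets-size zero    zero    = refl
countSubsets-size zero    (suc k) = refl
countSubsets-size (suc n) zero    =
  trans (countSubsets-suc n (λ X → ∣ X ∣ ≡ᵇ 0))
        (cong₂ _+_ (countSubsets-size n 0) (countSubsets-false n))
countSubsets-size (suc n) (suc k) = begin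
  countSubsets (suc n) (λ X → ∣ X ∣ ≡ᵇ suc k)
    ≡⟨ countSubsets-suc n (λ X → ∣ X ∣ ≡ᵇ suc k) ⟩
  countSubsets n (λ X → ∣ X ∣ ≡ᵇ suc k) + countSubsets n (λ X → ∣ X ∣ ≡ᵇ k)
    ≡⟨ cong₂ _+_ (countSubsets-size n (suc k)) (countSubsets-size n k) ⟩
  n C suc k + n C k  ≡⟨ +-comm (n C suc k) _ ⟩
  n C k + n C suc k  ≡⟨ nCk+nC[k+1]≡[n+1]C[k+1] n k ⟩
  suc n C suc k      ∎
  where open ≡-Reasoning

-- Binomial coefficients

nCk≤n^k : ∀ n k → n C k ≤ n ^ k
nCk≤n^k n       zero    = ≤-refl
nCk≤n^k zero    (suc k) = z≤n
nCk≤n^k (suc n) (suc k) = begin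
  suc n C suc k            ≡⟨ sym (nCk+nC[k+1]≡[n+1]C[k+1] n k) ⟩
  n C k + n C suc k        ≤⟨ +-mono-≤ (nCk≤n^k n k) (nCk≤n^k n (suc k)) ⟩
  n ^ k + n * n ^ k        ≤⟨ +-mono-≤ (^-monoˡ-≤ k (n≤1+n n)) (*-monoʳ-≤ n (^-monoˡ-≤ k (n≤1+n n))) ⟩
  suc n ^ k + n * suc n ^ k ∎
  where open ≤-Reasoning

nCk≤[d+n]Ck : ∀ d n k → n C k ≤ (d + n) C k
nCk≤[d+n]Ck zero    n k       = ≤-refl
nCk≤[d+n]Ck (suc d) n zero    = ≤-refl
nCk≤[d+n]Ck (suc d) n (suc k) = begin
  n C suc k                           ≤⟨ nCk≤[d+n]Ck d n (suc k) ⟩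
  (d + n) C suc k                     ≤⟨ m≤n+m _ _ ⟩
  (d + n) C k + (d + n) C suc k       ≡⟨ nCk+nC[k+1]≡[n+1]C[k+1] (d + n) k ⟩
  suc (d + n) C suc k                 ∎
  where open ≤-Reasoning

q*nCk≤[q+n]C[1+k] : ∀ q n k → q * (n C k) ≤ (q + n) C suc k
q*nCk≤[q+n]C[1+k] zero    n k = z≤n
q*nCk≤[q+n]C[1+k] (suc q) n k = begin
  n C k + q * (n C k)                 ≤⟨ +-mono-≤ (nCk≤[d+n]Ck q n k) (q*nCk≤[q+n]C[1+k] q n k) ⟩
  (q + n) C k + (q + n) C suc k       ≡⟨ nCk+nC[k+1]≡[n+1]C[k+1] (q + n) k ⟩
  (suc q + n) C suc k                 ∎
  where open ≤-Reasoning

q^k≤[k*q]Ck : ∀ q k → q ^ k ≤ (k * q) C k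
q^k≤[k*q]Ck q zero    = ≤-refl
q^k≤[k*q]Ck q (suc k) = begin
  q * q ^ k          ≤⟨ *-monoʳ-≤ q (q^k≤[k*q]Ck q k) ⟩
  q * ((k * q) C k)  ≤⟨ q*nCk≤[q+n]C[1+k] q (k * q) k ⟩
  (q + k * q) C suc k ∎
  where open ≤-Reasoning

-- Finite subsets

x∈p─q⇒x∉q : ∀ {n} {p q : Subset n} {x} → x ∈ p ─ q → x ∉ q
x∈p─q⇒x∉q {p = _ ∷ p} {outside ∷ q} here ()
x∈p─q⇒x∉q {p = _ ∷ p} {_ ∷ q} (there x∈p─q) (there x∈q) = x∈p─q⇒x∉q x∈p─q x∈q

x∈p-y⇒x≢y : ∀ {n} {p : Subset n} {x y} → x ∈ p - y → x ≢ y
x∈p-y⇒x≢y = x∉⁅y⁆⇒x≢y ∘ x∈p─q⇒x∉q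

0<∣p∣⇒Nonempty : ∀ {n} {p : Subset n} → 0 < ∣ p ∣ → Nonempty p
0<∣p∣⇒Nonempty {p = inside ∷ p}  _ = zero , here
0<∣p∣⇒Nonempty {p = outside ∷ p} h = let x , x∈p = 0<∣p∣⇒Nonempty h in suc x , there x∈p

∣p∪q∣≤∣p∣+∣q∣ : ∀ {n} (p q : Subset n) → ∣ p ∪ q ∣ ≤ ∣ p ∣ + ∣ q ∣
∣p∪q∣≤∣p∣+∣q∣ []            []            = z≤n
∣p∪q∣≤∣p∣+∣q∣ (inside ∷ p)  (inside ∷ q)  = s≤s (≤-trans (∣p∪q∣≤∣p∣+∣q∣ p q) (+-monoʳ-≤ ∣ p ∣ (n≤1+n _)))
∣p∪q∣≤∣p∣+∣q∣ (inside ∷ p)  (outside ∷ q) = s≤s (∣p∪q∣≤∣p∣+∣q∣ p q)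
∣p∪q∣≤∣p∣+∣q∣ (outside ∷ p) (inside ∷ q)  = ≤-trans (s≤s (∣p∪q∣≤∣p∣+∣q∣ p q)) (≤-reflexive (sym (+-suc _ _)))
∣p∪q∣≤∣p∣+∣q∣ (outside ∷ p) (outside ∷ q) = ∣p∪q∣≤∣p∣+∣q∣ p q

∣p∣≡∣p∩q∣+∣p─q∣ : ∀ {n} (p q : Subset n) → ∣ p ∣ ≡ ∣ p ∩ q ∣ + ∣ p ─ q ∣
∣p∣≡∣p∩q∣+∣p─q∣ []            []            = refl
∣p∣≡∣p∩q∣+∣p─q∣ (inside ∷ p)  (inside ∷ q)  = cong suc (∣p∣≡∣p∩q∣+∣p─q∣ p q)
∣p∣≡∣p∩q∣+∣p─q∣ (inside ∷ p)  (outside ∷ q) = trans (cong suc (∣p∣≡∣p∩q∣+∣p─q∣ p q)) (sym (+-suc _ _))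
∣p∣≡∣p∩q∣+∣p─q∣ (outside ∷ p) (inside ∷ q)  = ∣p∣≡∣p∩q∣+∣p─q∣ p q
∣p∣≡∣p∩q∣+∣p─q∣ (outside ∷ p) (outside ∷ q) = ∣p∣≡∣p∩q∣+∣p─q∣ p q

suc∣p-x∣≡∣p∣ : ∀ {n} {p : Subset n} {x} → x ∈ p → suc ∣ p - x ∣ ≡ ∣ p ∣
suc∣p-x∣≡∣p∣ {p = inside ∷ p}  here          = cong (suc ∘ ∣_∣) (p─⊥≡p p)
suc∣p-x∣≡∣p∣ {p = inside ∷ p}  (there x∈p)   = cong suc (suc∣p-x∣≡∣p∣ x∈p)
suc∣p-x∣≡∣p∣ {p = outside ∷ p} (there x∈p)   = suc∣p-x∣≡∣p∣ x∈p

∈-avoiding : ∀ {n} {p : Subset n} → 2 ≤ ∣ p ∣ → ∀ x → ∃ λ y → y ∈ p × y ≢ x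
∈-avoiding {p = p} 2≤∣p∣ x =
  let y , y∈p-x = 0<∣p∣⇒Nonempty (≤-pred (≤-trans 2≤∣p∣ ∣p∣≤1+∣p-x∣))
  in y , p─q⊆p p ⁅ x ⁆ y∈p-x , x∈p-y⇒x≢y y∈p-x
  where
  ∣p∣≤1+∣p-x∣ : ∣ p ∣ ≤ suc ∣ p - x ∣
  ∣p∣≤1+∣p-x∣ = begin
    ∣ p ∣                          ≡⟨ ∣p∣≡∣p∩q∣+∣p─q∣ p ⁅ x ⁆ ⟩
    ∣ p ∩ ⁅ x ⁆ ∣ + ∣ p - x ∣      ≤⟨ +-monoˡ-≤ _ (∣p∩q∣≤∣q∣ p ⁅ x ⁆) ⟩
    ∣ ⁅ x ⁆ ∣ + ∣ p - x ∣          ≡⟨ cong (_+ ∣ p - x ∣) (∣⁅x⁆∣≡1 x) ⟩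
    suc ∣ p - x ∣                  ∎
    where open ≤-Reasoning

⊆-extend : ∀ {n} {p q : Subset n} {k} → p ⊆ q → ∣ p ∣ ≤ k → k ≤ ∣ q ∣ →
  ∃ λ r → p ⊆ r × r ⊆ q × ∣ r ∣ ≡ k
⊆-extend {p = []} {[]} _ _ z≤n = [] , ⊆-refl , ⊆-refl , refl
⊆-extend {p = inside ∷ p} {inside ∷ q} p⊆q (s≤s ∣p∣≤k) (s≤s k≤∣q∣) =
  let r , p⊆r , r⊆q , ∣r∣≡k = ⊆-extend (drop-∷-⊆ p⊆q) ∣p∣≤k k≤∣q∣
  in inside ∷ r , in⊆in p⊆r , in⊆in r⊆q , cong suc ∣r∣≡k
⊆-extend {p = inside ∷ p} {outside ∷ q} p⊆q _ _ = case p⊆q here of λ ()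
⊆-extend {p = outside ∷ p} {outside ∷ q} p⊆q ∣p∣≤k k≤∣q∣ =
  let r , p⊆r , r⊆q , ∣r∣≡k = ⊆-extend (drop-∷-⊆ p⊆q) ∣p∣≤k k≤∣q∣
  in outside ∷ r , out⊆ p⊆r , out⊆ r⊆q , ∣r∣≡k
⊆-extend {p = outside ∷ p} {inside ∷ q} {k} p⊆q ∣p∣≤k k≤1+∣q∣ with k ≤? ∣ q ∣
... | yes k≤∣q∣ =
  let r , p⊆r , r⊆q , ∣r∣≡k = ⊆-extend (drop-∷-⊆ p⊆q) ∣p∣≤k k≤∣q∣
  in outside ∷ r , out⊆ p⊆r , out⊆ r⊆q , ∣r∣≡k
... | no k≰∣q∣ = inside ∷ q , p⊆q , ⊆-refl , ≤-antisym (≰⇒> k≰∣q∣) k≤1+∣q∣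

record Enumeration {n} (p : Subset n) (k : ℕ) : Set where
  field
    elem       : Fin k → Fin n
    injective  : Injective _≡_ _≡_ elem
    elem∈      : ∀ j → elem j ∈ p
    surjective : ∀ {x} → x ∈ p → ∃ λ j → elem j ≡ x

enumerate : ∀ {n} (p : Subset n) → Enumeration p ∣ p ∣
enumerate [] = record { elem = λ () ; injective = λ { {()} } ; elem∈ = λ () ; surjective = λ () }
enumerate (outside ∷ p) = record
  { elem       = suc ∘ elem
  ; injective  = injective ∘ Fin.suc-injective
  ; elem∈      = λ j → there (elem∈ j)
  ; surjective = λ { (there x∈p) → let j , eq = surjective x∈p in j , cong suc eq }
  }
  where open Enumeration (enumerate p)
enumerate {suc n} (inside ∷ p) = record
  { elem = elem′ ; injective = injective′ ; elem∈ = elem∈′ ; surjective = surjective′ }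
  where
  open Enumeration (enumerate p)
  elem′ : Fin (suc ∣ p ∣) → Fin (suc n)
  elem′ zero    = zero
  elem′ (suc j) = suc (elem j)
  injective′ : Injective _≡_ _≡_ elem′
  injective′ {zero}  {zero}  _  = refl
  injective′ {suc i} {suc j} eq = cong suc (injective (Fin.suc-injective eq))
  elem∈′ : ∀ j → elem′ j ∈ inside ∷ p
  elem∈′ zero    = here
  elem∈′ (suc j) = there (elem∈ j)
  surjective′ : ∀ {x} → x ∈ inside ∷ p → ∃ λ j → elem′ j ≡ x
  surjective′ here        = zero , refl
  surjective′ (there x∈p) = let j , eq = surjective x∈p in suc j , cong suc eq

injective⇒≤∣p∣ : ∀ {k n} {p : Subset n} {f : Fin k → Fin n} →
  Injective _≡_ _≡_ f → (∀ i → f i ∈ p) → k ≤ ∣ p ∣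
injective⇒≤∣p∣ {k} {p = p} {f} f-injective f∈p = Fin.injective⇒≤ index-injective
  where
  open Enumeration (enumerate p)
  index : Fin k → Fin ∣ p ∣
  index i = proj₁ (surjective (f∈p i))
  index-injective : Injective _≡_ _≡_ index
  index-injective {i} {j} eq = f-injective (begin
    f i                ≡⟨ proj₂ (surjective (f∈p i)) ⟨
    elem (index i)     ≡⟨ cong elem eq ⟩
    elem (index j)     ≡⟨ proj₂ (surjective (f∈p j)) ⟩
    f j                ∎)
    where open ≡-Reasoning

injective⇒suc≤∣p∣ : ∀ {k n} {p : Subset n} {f : Fin k → Fin n} {w} →
  Injective _≡_ _≡_ f → (∀ i → f i ∈ p) → w ∈ p → (∀ i → w ≢ f i) → suc k ≤ ∣ p ∣
injective⇒suc≤∣p∣ {p = p} {f} {w} f-injective f∈p w∈p w-fresh = injective⇒≤∣p∣ w◂f-injective w◂f∈p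
  where
  w◂f-injective : Injective _≡_ _≡_ (w ◂ f)
  w◂f-injective {zero}  {zero}  _  = refl
  w◂f-injective {zero}  {suc j} eq = ⊥-elim (w-fresh j eq)
  w◂f-injective {suc i} {zero}  eq = ⊥-elim (w-fresh i (sym eq))
  w◂f-injective {suc i} {suc j} eq = cong suc (f-injective eq)
  w◂f∈p : ∀ i → (w ◂ f) i ∈ p
  w◂f∈p zero    = w∈p
  w◂f∈p (suc i) = f∈p i

x∈⋃⁻ : ∀ {n} (ps : List (Subset n)) {x} → x ∈ ⋃ ps → Any (x ∈_) ps
x∈⋃⁻ []       x∈⊥ = ⊥-elim (∉⊥ x∈⊥)
x∈⋃⁻ (p ∷ ps) x∈p∪⋃ps with x∈p∪q⁻ p (⋃ ps) x∈p∪⋃ps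
... | inj₁ x∈p   = here x∈p
... | inj₂ x∈⋃ps = there (x∈⋃⁻ ps x∈⋃ps)

x∈⋃⁺ : ∀ {n} {ps : List (Subset n)} {x} → Any (x ∈_) ps → x ∈ ⋃ ps
x∈⋃⁺ (here x∈p) = x∈p∪q⁺ (inj₁ x∈p)
x∈⋃⁺ (there x∈ps) = x∈p∪q⁺ (inj₂ (x∈⋃⁺ x∈ps))

⋃⟨_⟩_ : ∀ {k n} → Subset k → (Fin k → Subset n) → Subset n
⋃⟨ [] ⟩          F = ⊥
⋃⟨ inside ∷ A ⟩  F = F zero ∪ ⋃⟨ A ⟩ (F ∘ suc)
⋃⟨ outside ∷ A ⟩ F = ⋃⟨ A ⟩ (F ∘ suc)

x∈⋃⟨⟩⁺ : ∀ {k n} {A : Subset k} {F : Fin k → Subset n} {a x} → a ∈ A → x ∈ F a → x ∈ ⋃⟨ A ⟩ F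
x∈⋃⟨⟩⁺ {A = inside ∷ A}  here        x∈Fa = x∈p∪q⁺ (inj₁ x∈Fa)
x∈⋃⟨⟩⁺ {A = inside ∷ A}  (there a∈A) x∈Fa = x∈p∪q⁺ (inj₂ (x∈⋃⟨⟩⁺ a∈A x∈Fa))
x∈⋃⟨⟩⁺ {A = outside ∷ A} (there a∈A) x∈Fa = x∈⋃⟨⟩⁺ a∈A x∈Fa

x∈⋃⟨⟩⁻ : ∀ {k n} (A : Subset k) (F : Fin k → Subset n) {x} → x ∈ ⋃⟨ A ⟩ F → ∃ λ a → a ∈ A × x ∈ F a
x∈⋃⟨⟩⁻ []            F x∈⊥ = ⊥-elim (∉⊥ x∈⊥)
x∈⋃⟨⟩⁻ (inside ∷ A)  F x∈ with x∈p∪q⁻ (F zero) (⋃⟨ A ⟩ (F ∘ suc)) x∈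
... | inj₁ x∈F0 = zero , here , x∈F0
... | inj₂ x∈⋃  = let a , a∈A , x∈Fa = x∈⋃⟨⟩⁻ A (F ∘ suc) x∈⋃ in suc a , there a∈A , x∈Fa
x∈⋃⟨⟩⁻ (outside ∷ A) F x∈⋃ = let a , a∈A , x∈Fa = x∈⋃⟨⟩⁻ A (F ∘ suc) x∈⋃ in suc a , there a∈A , x∈Fa

∣⋃⟨A⟩F∣≤∣A∣*m : ∀ {k n} (A : Subset k) {F : Fin k → Subset n} {m} →
  (∀ a → ∣ F a ∣ ≤ m) → ∣ ⋃⟨ A ⟩ F ∣ ≤ ∣ A ∣ * m
∣⋃⟨A⟩F∣≤∣A∣*m {n = n} [] _ = ≤-reflexive (∣⊥∣≡0 n)
∣⋃⟨A⟩F∣≤∣A∣*m (inside ∷ A) {F} ∣F∣≤m =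
  ≤-trans (∣p∪q∣≤∣p∣+∣q∣ (F zero) _) (+-mono-≤ (∣F∣≤m zero) (∣⋃⟨A⟩F∣≤∣A∣*m A (∣F∣≤m ∘ suc)))
∣⋃⟨A⟩F∣≤∣A∣*m (outside ∷ A) ∣F∣≤m = ∣⋃⟨A⟩F∣≤∣A∣*m A (∣F∣≤m ∘ suc)

-- Cliques and closures under link transversals


Clique : ∀ {r n} → RGraph r n → Subset n → Set
Clique {r} H S = ∀ e → e ⊆ S → ∣ e ∣ ≡ r → edge H e ≡ true

T-allᵇ : ∀ (p : A → Bool) xs → T (allᵇ p xs) ⇔ All (T ∘ p) xs
T-allᵇ p xs = mk⇔ (to xs) from
  where
  to : ∀ xs → T (allᵇ p xs) → All (T ∘ p) xs
  to []       _ = []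
  to (x ∷ xs) h = let px , pxs = Equivalence.to T-∧ h in px ∷ to xs pxs
  from : ∀ {xs} → All (T ∘ p) xs → T (allᵇ p xs)
  from []         = _
  from (px ∷ pxs) = Equivalence.from T-∧ (px , from pxs)

T-not-∨ : ∀ a b → T (not a ∨ b) ⇔ (T a → T b)
T-not-∨ false b = mk⇔ (λ _ ()) (λ _ → _)
T-not-∨ true  b = mk⇔ (λ Tb _ → Tb) (λ f → f _)

isKsᵇ⇔Clique : ∀ {r n} s (H : RGraph r n) S → T (isKsᵇ s H S) ⇔ (∣ S ∣ ≡ s × Clique H S)
isKsᵇ⇔Clique {r} {n} s H S = mk⇔ to from
  where
  edge-if-small : Subset n → Bool
  edge-if-small e = not ((e ⊆ᵇ S) ∧ (∣ e ∣ ≡ᵇ r)) ∨ edge H e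
  to : T (isKsᵇ s H S) → ∣ S ∣ ≡ s × Clique H S
  to h =
    let ∣S∣≡ᵇs , all-small-edges = Equivalence.to T-∧ h
        small⇒edge = lookup (Equivalence.to (T-allᵇ edge-if-small _) all-small-edges) ∘ ∈-allSubsets
    in ≡ᵇ⇒≡ _ _ ∣S∣≡ᵇs , λ e e⊆S ∣e∣≡r →
         Equivalence.to T-≡ (Equivalence.to (T-not-∨ _ _) (small⇒edge e)
                               (Equivalence.from T-∧ (⊆⇒⊆ᵇ e⊆S , ≡⇒≡ᵇ _ _ ∣e∣≡r)))
  from : ∣ S ∣ ≡ s × Clique H S → T (isKsᵇ s H S)
  from (∣S∣≡s , clique) = Equivalence.from T-∧ (≡⇒≡ᵇ _ _ ∣S∣≡s ,
    Equivalence.from (T-allᵇ edge-if-small _) (universal small⇒edge (allSubsets n)))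
    where
    small⇒edge : ∀ e → T (edge-if-small e)
    small⇒edge e = Equivalence.from (T-not-∨ _ _) λ h →
      let e⊆S , ∣e∣≡r = Equivalence.to T-∧ h
      in Equivalence.from T-≡ (clique e (⊆ᵇ⇒⊆ e⊆S) (≡ᵇ⇒≡ _ _ ∣e∣≡r))

module Closure {n} (τ : Fin n → Subset n) where

  closure : Subset n → Subset n
  closure A = A ∪ ⋃⟨ A ⟩ τ

  ⊆-closure : ∀ {A} → A ⊆ closure A
  ⊆-closure x∈A = x∈p∪q⁺ (inj₁ x∈A)

  ∈-closure-step : ∀ {A a x} → a ∈ A → x ∈ τ a → x ∈ closure A
  ∈-closure-step a∈A x∈τa = x∈p∪q⁺ (inj₂ (x∈⋃⟨⟩⁺ a∈A x∈τa))

  closure-mono : ∀ {A B} → A ⊆ B → closure A ⊆ closure B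
  closure-mono {A} A⊆B x∈ with x∈p∪q⁻ A _ x∈
  ... | inj₁ x∈A = ⊆-closure (A⊆B x∈A)
  ... | inj₂ x∈⋃ = let a , a∈A , x∈τa = x∈⋃⟨⟩⁻ A τ x∈⋃ in ∈-closure-step (A⊆B a∈A) x∈τa

  ∣closure∣≤ : ∀ {m} → (∀ v → ∣ τ v ∣ ≤ m) → ∀ A → ∣ closure A ∣ ≤ ∣ A ∣ * suc m
  ∣closure∣≤ {m} ∣τ∣≤m A = begin
    ∣ A ∪ ⋃⟨ A ⟩ τ ∣             ≤⟨ ∣p∪q∣≤∣p∣+∣q∣ A _ ⟩
    ∣ A ∣ + ∣ ⋃⟨ A ⟩ τ ∣         ≤⟨ +-monoʳ-≤ ∣ A ∣ (∣⋃⟨A⟩F∣≤∣A∣*m A ∣τ∣≤m) ⟩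
    ∣ A ∣ + ∣ A ∣ * m            ≡⟨ *-suc ∣ A ∣ m ⟨
    ∣ A ∣ * suc m                ∎
    where open ≤-Reasoning

  ∣closure³∣≤ : ∀ {m} → (∀ v → ∣ τ v ∣ ≤ m) → ∀ A →
    ∣ closure (closure (closure A)) ∣ ≤ ∣ A ∣ * suc m * suc m * suc m
  ∣closure³∣≤ {m} ∣τ∣≤m A =
    ≤-trans (∣closure∣≤ ∣τ∣≤m (closure (closure A))) (*-monoˡ-≤ (suc m)
      (≤-trans (∣closure∣≤ ∣τ∣≤m (closure A)) (*-monoˡ-≤ (suc m) (∣closure∣≤ ∣τ∣≤m A))))

LinkTransversal : ∀ {r n} → RGraph r n → Fin n → Subset n → Set
LinkTransversal H v U = ∀ e → edge H e ≡ true → v ∈ e → Nonempty ((e - v) ∩ U)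

module Generation {r n} (H : RGraph r n) (τ : Fin n → Subset n)
                  (τ-transversal : ∀ v → LinkTransversal H v (τ v)) where

  open Closure τ

  link-neighbour : ∀ {e v} → edge H e ≡ true → v ∈ e → ∃ λ w → w ∈ e × w ≢ v × w ∈ τ v
  link-neighbour {e} {v} eH v∈e =
    let w , w∈ = τ-transversal v e eH v∈e
        w∈e-v , w∈τv = x∈p∩q⁻ (e - v) (τ v) w∈
    in w , p─q⊆p e ⁅ v ⁆ w∈e-v , x∈p-y⇒x≢y w∈e-v , w∈τv

  one-step : ∀ {G u x} → u ∈ G → x ∈ τ u → x ∈ closure (closure G)
  one-step u∈G x∈τu = ⊆-closure (∈-closure-step u∈G x∈τu)

  two-steps : ∀ {G u w x} → u ∈ G → w ∈ τ u → x ∈ τ w → x ∈ closure (closure G)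
  two-steps u∈G w∈τu x∈τw = ∈-closure-step (∈-closure-step u∈G w∈τu) x∈τw

  GeneratedInTwoSteps : Subset n → Set
  GeneratedInTwoSteps T = ∃ λ G → suc (suc ∣ G ∣) ≡ ∣ T ∣ × T ⊆ closure (closure G)

  ∈-remove₂ : ∀ {T : Subset n} {a b x} → x ∈ T → x ≢ a → x ≢ b → x ∈ T - a - b
  ∈-remove₂ x∈T x≢a x≢b = x∈p∧x≢y⇒x∈p-y (x∈p∧x≢y⇒x∈p-y x∈T x≢a) x≢b

  remove-pair : ∀ {T a b} → a ∈ T → b ∈ T → a ≢ b →
    a ∈ closure (closure (T - a - b)) → b ∈ closure (closure (T - a - b)) → GeneratedInTwoSteps T
  remove-pair {T} {a} {b} a∈T b∈T a≢b a∈ b∈ = T - a - b , size , T⊆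
    where
    size : suc (suc ∣ T - a - b ∣) ≡ ∣ T ∣
    size = trans (cong suc (suc∣p-x∣≡∣p∣ (x∈p∧x≢y⇒x∈p-y b∈T (a≢b ∘ sym)))) (suc∣p-x∣≡∣p∣ a∈T)
    T⊆ : T ⊆ closure (closure (T - a - b))
    T⊆ {u} u∈T with u Fin.≟ a | u Fin.≟ b
    ... | yes refl | _        = a∈
    ... | no _     | yes refl = b∈
    ... | no u≢a   | no u≢b   = ⊆-closure (⊆-closure (∈-remove₂ u∈T u≢a u≢b))

  two-cycle-generated : ∀ {T x y} → edge H T ≡ true → 3 ≤ ∣ T ∣ → x ∈ T → y ∈ T → y ≢ x →
    y ∈ τ x → x ∈ τ y → GeneratedInTwoSteps T
  two-cycle-generated {T} {x} {y} eT 3≤∣T∣ x∈T y∈T y≢x y∈τx x∈τy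
    with ∈-avoiding (≤-pred (≤-trans 3≤∣T∣ (≤-reflexive (sym (suc∣p-x∣≡∣p∣ x∈T))))) y
  ... | t , t∈T-x , t≢y with link-neighbour eT (p─q⊆p T ⁅ x ⁆ t∈T-x)
  ... | p , p∈T , p≢t , p∈τt with p Fin.≟ x | p Fin.≟ y
  ... | yes refl | _        = remove-pair x∈T y∈T (y≢x ∘ sym) (one-step t∈G p∈τt) (two-steps t∈G p∈τt y∈τx)
    where
    t∈G : t ∈ T - x - y
    t∈G = ∈-remove₂ (p─q⊆p T ⁅ x ⁆ t∈T-x) (x∈p-y⇒x≢y t∈T-x) t≢y
  ... | no _     | yes refl = remove-pair x∈T y∈T (y≢x ∘ sym) (two-steps t∈G p∈τt x∈τy) (one-step t∈G p∈τt)
    where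
    t∈G : t ∈ T - x - p
    t∈G = ∈-remove₂ (p─q⊆p T ⁅ x ⁆ t∈T-x) (x∈p-y⇒x≢y t∈T-x) t≢y
  ... | no p≢x   | no p≢y   = remove-pair p∈T y∈T p≢y (one-step t∈G p∈τt) (one-step x∈G y∈τx)
    where
    t∈G : t ∈ T - p - y
    t∈G = ∈-remove₂ (p─q⊆p T ⁅ x ⁆ t∈T-x) (p≢t ∘ sym) t≢y
    x∈G : x ∈ T - p - y
    x∈G = ∈-remove₂ x∈T (p≢x ∘ sym) (y≢x ∘ sym)

  edge-generated : ∀ {T} → edge H T ≡ true → 3 ≤ ∣ T ∣ → GeneratedInTwoSteps T
  edge-generated {T} eT 3≤∣T∣ with 0<∣p∣⇒Nonempty (≤-trans (s≤s z≤n) 3≤∣T∣)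
  ... | x , x∈T with link-neighbour eT x∈T
  ... | y , y∈T , y≢x , y∈τx with link-neighbour eT y∈T
  ... | z , z∈T , z≢y , z∈τy with z Fin.≟ x
  ... | yes refl = two-cycle-generated eT 3≤∣T∣ x∈T y∈T y≢x y∈τx z∈τy
  ... | no z≢x   = remove-pair y∈T z∈T (z≢y ∘ sym) (one-step x∈G y∈τx) (two-steps x∈G y∈τx z∈τy)
    where
    x∈G : x ∈ T - y - z
    x∈G = ∈-remove₂ x∈T (y≢x ∘ sym) (z≢x ∘ sym)

  beyond : Fin n → Subset n → Subset n
  beyond v S = S ─ (τ v - v)

  ∈-beyond : ∀ {v S} → v ∈ S → v ∈ beyond v S
  ∈-beyond v∈S = x∈p∧x∉q⇒x∈p─q v∈S (λ v∈τv-v → x∈p-y⇒x≢y v∈τv-v refl)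

  ∣beyond∣<r : ∀ {v S} → 0 < r → v ∈ S → Clique H S → ∣ beyond v S ∣ < r
  ∣beyond∣<r {v} {S} 0<r v∈S clique = ≰⇒> r≰∣beyond∣
    where
    ⁅v⁆⊆beyond : ⁅ v ⁆ ⊆ beyond v S
    ⁅v⁆⊆beyond u∈⁅v⁆ = subst (_∈ beyond v S) (sym (x∈⁅y⁆⇒x≡y v u∈⁅v⁆)) (∈-beyond v∈S)
    r≰∣beyond∣ : ¬ (r ≤ ∣ beyond v S ∣)
    r≰∣beyond∣ r≤∣beyond∣ =
      let ∣⁅v⁆∣≤r = ≤-trans (≤-reflexive (∣⁅x⁆∣≡1 v)) 0<r
          e , ⁅v⁆⊆e , e⊆beyond , ∣e∣≡r = ⊆-extend ⁅v⁆⊆beyond ∣⁅v⁆∣≤r r≤∣beyond∣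
          eH = clique e (⊆-trans e⊆beyond (p─q⊆p S _)) ∣e∣≡r
          w , w∈e , w≢v , w∈τv = link-neighbour eH (⁅v⁆⊆e (x∈⁅x⁆ v))
      in x∈p─q⇒x∉q (e⊆beyond w∈e) (x∈p∧x≢y⇒x∈p-y w∈τv w≢v)

  clique⊆closure-edge : ∀ {S} → 0 < r → r ≤ ∣ S ∣ → Clique H S → ∃ λ E → edge H E ≡ true × S ⊆ closure E
  clique⊆closure-edge {S} 0<r r≤∣S∣ clique with 0<∣p∣⇒Nonempty (≤-trans 0<r r≤∣S∣)
  ... | v , v∈S with ⊆-extend (p─q⊆p S (τ v - v)) (<⇒≤ (∣beyond∣<r 0<r v∈S clique)) r≤∣S∣
  ... | E , beyond⊆E , E⊆S , ∣E∣≡r = E , clique E E⊆S ∣E∣≡r , S⊆closure-E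
    where
    S⊆closure-E : S ⊆ closure E
    S⊆closure-E {u} u∈S with u ∈? (τ v - v)
    ... | yes u∈τv-v = ∈-closure-step (beyond⊆E (∈-beyond v∈S)) (p─q⊆p (τ v) ⁅ v ⁆ u∈τv-v)
    ... | no  u∉τv-v = ⊆-closure (beyond⊆E (x∈p∧x∉q⇒x∈p─q u∈S u∉τv-v))

  clique-generated : ∀ {S} → 3 ≤ r → r ≤ ∣ S ∣ → Clique H S →
    ∃ λ G → suc (suc ∣ G ∣) ≡ r × S ⊆ closure (closure (closure G))
  clique-generated 3≤r r≤∣S∣ clique =
    let E , eE , S⊆closure-E = clique⊆closure-edge (≤-trans (s≤s z≤n) 3≤r) r≤∣S∣ clique
        G , ∣G∣ , E⊆ = edge-generated eE (≤-trans 3≤r (≤-reflexive (sym (uniform H E eE))))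
    in G , trans ∣G∣ (uniform H E eE) , closure-mono E⊆ ∘ S⊆closure-E

  #Ks≤c*n^[r∸2] : ∀ {s m} → (∀ v → ∣ τ v ∣ ≤ m) → 3 ≤ r → r ≤ s →
    #Ks s H ≤ 2 ^ ((r ∸ 2) * suc m * suc m * suc m) * n ^ (r ∸ 2)
  #Ks≤c*n^[r∸2] {s} {m} ∣τ∣≤m 3≤r r≤s = begin
    #Ks s H
      ≤⟨ union-bound (isKsᵇ s H) _ Gs cover (allSubsets n) ⟩
    sum (map (λ G → countSubsets n (_⊆ᵇ closure³ G)) Gs)
      ≤⟨ sum-map-≤ _ (2 ^ K) (All.map bound (all-filter (T? ∘ size-k) (allSubsets n))) ⟩
    countSubsets n size-k * 2 ^ K  ≡⟨ cong (_* 2 ^ K) (countSubsets-size n k) ⟩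
    (n C k) * 2 ^ K                ≤⟨ *-monoˡ-≤ (2 ^ K) (nCk≤n^k n k) ⟩
    n ^ k * 2 ^ K                  ≡⟨ *-comm (n ^ k) (2 ^ K) ⟩
    2 ^ K * n ^ k                  ∎
    where
    open ≤-Reasoning
    k K : ℕ
    k = r ∸ 2
    K = k * suc m * suc m * suc m
    closure³ : Subset n → Subset n
    closure³ G = closure (closure (closure G))
    size-k : Subset n → Bool
    size-k G = ∣ G ∣ ≡ᵇ k
    Gs : List (Subset n)
    Gs = filterᵇ size-k (allSubsets n)
    cover : ∀ X → T (isKsᵇ s H X) → Any (λ G → T (X ⊆ᵇ closure³ G)) Gs
    cover X X-clique =
      let ∣X∣≡s , clique = Equivalence.to (isKsᵇ⇔Clique s H X) X-clique
          G , ∣G∣+2≡r , X⊆ = clique-generated 3≤r (subst (r ≤_) (sym ∣X∣≡s) r≤s) clique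
      in lose (∈-filter⁺ (T? ∘ size-k) (∈-allSubsets G) (≡⇒≡ᵇ _ _ (cong (_∸ 2) ∣G∣+2≡r))) (⊆⇒⊆ᵇ X⊆)
    bound : ∀ {G} → T (size-k G) → countSubsets n (_⊆ᵇ closure³ G) ≤ 2 ^ K
    bound {G} ∣G∣≡ᵇk = begin
      countSubsets n (_⊆ᵇ closure³ G)      ≡⟨ countSubsets-⊆ (closure³ G) ⟩
      2 ^ ∣ closure³ G ∣                   ≤⟨ ^-monoʳ-≤ 2 (∣closure³∣≤ ∣τ∣≤m G) ⟩
      2 ^ (∣ G ∣ * suc m * suc m * suc m)
        ≡⟨ cong (λ g → 2 ^ (g * suc m * suc m * suc m)) (≡ᵇ⇒≡ ∣ G ∣ k ∣G∣≡ᵇk) ⟩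
      2 ^ K                                ∎

-- Expanded stars and sunflowers

module _ {ℓ r n} (f : StarV ℓ r → Fin n) (i : Fin ℓ) where

  private
    leaves : List (Subset n)
    leaves = map (λ j → ⁅ f (inj₂ (i , j)) ⁆) (allFin (r ∸ 1))

  ∈-starEdgeImage⁻ : ∀ {x} → x ∈ starEdgeImage {ℓ} {r} f i → x ≡ f (inj₁ tt) ⊎ ∃ λ j → x ≡ f (inj₂ (i , j))
  ∈-starEdgeImage⁻ x∈ with x∈p∪q⁻ ⁅ f (inj₁ tt) ⁆ (⋃ leaves) x∈
  ... | inj₁ x∈⁅c⁆ = inj₁ (x∈⁅y⁆⇒x≡y _ x∈⁅c⁆)
  ... | inj₂ x∈⋃ = let j , x∈⁅fj⁆ = satisfied (Any.map⁻ (x∈⋃⁻ leaves x∈⋃)) in inj₂ (j , x∈⁅y⁆⇒x≡y _ x∈⁅fj⁆)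

  centre∈starEdgeImage : f (inj₁ tt) ∈ starEdgeImage {ℓ} {r} f i
  centre∈starEdgeImage = x∈p∪q⁺ (inj₁ (x∈⁅x⁆ _))

  leaf∈starEdgeImage : ∀ j → f (inj₂ (i , j)) ∈ starEdgeImage {ℓ} {r} f i
  leaf∈starEdgeImage j = x∈p∪q⁺ (inj₂ (x∈⋃⁺ (Any.map⁺ (lose (∈-allFin j) (x∈⁅x⁆ _)))))

record Sunflower {r n} (H : RGraph r n) (v : Fin n) (k : ℕ) : Set where
  field
    petal                 : Fin k → Subset n
    petal-edge            : ∀ i → edge H (petal i) ≡ true
    centre∈petal          : ∀ i → v ∈ petal i
    petals-meet-in-centre : ∀ {i j x} → i ≢ j → x ∈ petal i → x ∈ petal j → x ≡ v

sunflower⇒star : ∀ {ℓ r n} {H : RGraph r n} {v} → Sunflower H v ℓ → ContainsStarExp ℓ H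
sunflower⇒star {ℓ} {r} {n} {H} {v} F =
  f , f-injective , λ i → subst (λ e → edge H e ≡ true) (sym (image≡petal i)) (petal-edge i)
  where
  open Sunflower F
  leaves : ∀ i → Enumeration (petal i - v) (r ∸ 1)
  leaves i = subst (Enumeration (petal i - v)) ∣petal-v∣≡r∸1 (enumerate (petal i - v))
    where
    ∣petal-v∣≡r∸1 : ∣ petal i - v ∣ ≡ r ∸ 1
    ∣petal-v∣≡r∸1 = cong (_∸ 1) (trans (suc∣p-x∣≡∣p∣ (centre∈petal i)) (uniform H _ (petal-edge i)))
  open module Leaves i = Enumeration (leaves i)
  leaf∈petal : ∀ i j → elem i j ∈ petal i
  leaf∈petal i j = p─q⊆p (petal i) ⁅ v ⁆ (elem∈ i j)
  leaf≢centre : ∀ i j → elem i j ≢ v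
  leaf≢centre i j = x∈p-y⇒x≢y (elem∈ i j)
  f : StarV ℓ r → Fin n
  f (inj₁ tt)      = v
  f (inj₂ (i , j)) = elem i j
  f-injective : Injective _≡_ _≡_ f
  f-injective {inj₁ tt}      {inj₁ tt}       _  = refl
  f-injective {inj₁ tt}      {inj₂ (i , j)}  eq = ⊥-elim (leaf≢centre i j (sym eq))
  f-injective {inj₂ (i , j)} {inj₁ tt}       eq = ⊥-elim (leaf≢centre i j eq)
  f-injective {inj₂ (i , j)} {inj₂ (i′ , j′)} eq with i Fin.≟ i′
  ... | yes refl = cong (λ j → inj₂ (i , j)) (injective i eq)
  ... | no i≢i′  = ⊥-elim (leaf≢centre i j (petals-meet-in-centre i≢i′ (leaf∈petal i j)
                                              (subst (_∈ petal i′) (sym eq) (leaf∈petal i′ j′))))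
  image≡petal : ∀ i → starEdgeImage {ℓ} {r} f i ≡ petal i
  image≡petal i = ⊆-antisym image⊆petal petal⊆image
    where
    image⊆petal : starEdgeImage {ℓ} {r} f i ⊆ petal i
    image⊆petal x∈ with ∈-starEdgeImage⁻ {ℓ} {r} f i x∈
    ... | inj₁ refl       = centre∈petal i
    ... | inj₂ (j , refl) = leaf∈petal i j
    petal⊆image : petal i ⊆ starEdgeImage {ℓ} {r} f i
    petal⊆image {x} x∈petal with x Fin.≟ v
    ... | yes refl = centre∈starEdgeImage {ℓ} {r} f i
    ... | no x≢v   = let j , eq = surjective i (x∈p∧x≢y⇒x∈p-y x∈petal x≢v)
                     in subst (_∈ starEdgeImage {ℓ} {r} f i) eq (leaf∈starEdgeImage {ℓ} {r} f i j)

module _ {r n} (H : RGraph r n) (v : Fin n) where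

  petal-union : ∀ {k} → Sunflower H v k → Subset n
  petal-union F = ⋃⟨ ⊤ ⟩ Sunflower.petal F

  NewPetal : ∀ {k} → Sunflower H v k → Subset n → Set
  NewPetal F e = edge H e ≡ true × v ∈ e × Empty ((e - v) ∩ petal-union F)

  add-petal : ∀ {k} (F : Sunflower H v k) e → NewPetal F e → Sunflower H v (suc k)
  add-petal {k} F e (eH , v∈e , e-new) = record
    { petal = e ◂ petal ; petal-edge = petal-edge′ ; centre∈petal = centre∈petal′
    ; petals-meet-in-centre = meet }
    where
    open Sunflower F
    petal-edge′ : ∀ i → edge H ((e ◂ petal) i) ≡ true
    petal-edge′ zero    = eH
    petal-edge′ (suc i) = petal-edge i
    centre∈petal′ : ∀ i → v ∈ (e ◂ petal) i
    centre∈petal′ zero    = v∈e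
    centre∈petal′ (suc i) = centre∈petal i
    meet-new : ∀ {i x} → x ∈ e → x ∈ petal i → x ≡ v
    meet-new {i} {x} x∈e x∈petal with x Fin.≟ v
    ... | yes x≡v = x≡v
    ... | no  x≢v =
      ⊥-elim (e-new (x , x∈p∩q⁺ (x∈p∧x≢y⇒x∈p-y x∈e x≢v , x∈⋃⟨⟩⁺ {F = petal} (∈⊤ {x = i}) x∈petal)))
    meet : ∀ {i j x} → i ≢ j → x ∈ (e ◂ petal) i → x ∈ (e ◂ petal) j → x ≡ v
    meet {zero}  {zero}  0≢0 = ⊥-elim (0≢0 refl)
    meet {zero}  {suc j} _   = meet-new
    meet {suc i} {zero}  _   = flip meet-new
    meet {suc i} {suc j} i≢j = petals-meet-in-centre (i≢j ∘ cong suc)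

  sunflower-or-transversal : ∀ k → Sunflower H v k ⊎ ∃ λ U → ∣ U ∣ ≤ k * r × LinkTransversal H v U
  sunflower-or-transversal zero = inj₁ record
    { petal = λ () ; petal-edge = λ () ; centre∈petal = λ () ; petals-meet-in-centre = λ { {()} } }
  sunflower-or-transversal (suc k) with sunflower-or-transversal k
  ... | inj₂ (U , ∣U∣≤kr , U-transversal) = inj₂ (U , ≤-trans ∣U∣≤kr (m≤n+m (k * r) r) , U-transversal)
  ... | inj₁ F with anySubset? (λ e → (edge H e Bool.≟ true) ×-dec (v ∈? e) ×-dec ¬? (nonempty? _))
  ...   | yes (e , e-new) = inj₁ (add-petal F e e-new)
  ...   | no  no-new      = inj₂ (petal-union F , ∣petal-union∣≤ , transversal)
    where
    open Sunflower F
    ∣petal-union∣≤ : ∣ petal-union F ∣ ≤ suc k * r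
    ∣petal-union∣≤ = begin
      ∣ petal-union F ∣   ≤⟨ ∣⋃⟨A⟩F∣≤∣A∣*m ⊤ (λ i → ≤-reflexive (uniform H _ (petal-edge i))) ⟩
      ∣ ⊤ {k} ∣ * r       ≡⟨ cong (_* r) (∣⊤∣≡n k) ⟩
      k * r               ≤⟨ m≤n+m (k * r) r ⟩
      suc k * r           ∎
      where open ≤-Reasoning
    transversal : LinkTransversal H v (petal-union F)
    transversal e eH v∈e with nonempty? ((e - v) ∩ petal-union F)
    ... | yes meets = meets
    ... | no  empty = ⊥-elim (no-new (e , eH , v∈e , empty))

link-transversals : ∀ {r n ℓ} (H : RGraph r n) → StarExpFree ℓ H →
  ∀ v → ∃ λ U → ∣ U ∣ ≤ ℓ * r × LinkTransversal H v U
link-transversals {ℓ = ℓ} H free v with sunflower-or-transversal H v ℓ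
... | inj₁ F           = ⊥-elim (free (sunflower⇒star F))
... | inj₂ transversal = transversal

petals-share-only-centre : ∀ {ℓ r n} {f : StarV ℓ r → Fin n} → Injective _≡_ _≡_ f → ∀ {i j x} →
  x ∈ starEdgeImage {ℓ} {r} f i → x ∈ starEdgeImage {ℓ} {r} f j → x ≢ f (inj₁ tt) → i ≡ j
petals-share-only-centre {ℓ} {r} {f = f} f-injective {i} {j} x∈Ei x∈Ej x≢c
  with ∈-starEdgeImage⁻ {ℓ} {r} f i x∈Ei | ∈-starEdgeImage⁻ {ℓ} {r} f j x∈Ej
... | inj₁ x≡c | _        = ⊥-elim (x≢c x≡c)
... | inj₂ _   | inj₁ x≡c = ⊥-elim (x≢c x≡c)
... | inj₂ (a , x≡fia) | inj₂ (b , x≡fjb) with f-injective (trans (sym x≡fia) x≡fjb)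
... | refl = refl

star-meeting-twice : ∀ {ℓ r n} (A : Subset n) (f : StarV (suc ℓ) r → Fin n) → Injective _≡_ _≡_ f →
  (∀ i → 2 ≤ ∣ starEdgeImage {suc ℓ} {r} f i ∩ A ∣) → 2 + ℓ ≤ ∣ A ∣
star-meeting-twice {ℓ} {r} {n} A f f-injective meets =
  let w , w∈A , w-fresh = extra in injective⇒suc≤∣p∣ q-injective q∈A w∈A w-fresh
  where
  E : Fin (suc ℓ) → Subset n
  E = starEdgeImage {suc ℓ} {r} f
  c : Fin n
  c = f (inj₁ tt)
  same-petal : ∀ {x i j} → x ∈ E i → x ∈ E j → x ≢ c → i ≡ j
  same-petal = petals-share-only-centre {suc ℓ} {r} f-injective
  in-petal : ∀ i → ∃ λ x → x ∈ E i ∩ A × x ≢ c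
  in-petal i = ∈-avoiding (meets i) c
  q : Fin (suc ℓ) → Fin n
  q i = proj₁ (in-petal i)
  q∈E : ∀ i → q i ∈ E i
  q∈E i = proj₁ (x∈p∩q⁻ (E i) A (proj₁ (proj₂ (in-petal i))))
  q∈A : ∀ i → q i ∈ A
  q∈A i = proj₂ (x∈p∩q⁻ (E i) A (proj₁ (proj₂ (in-petal i))))
  q≢c : ∀ i → q i ≢ c
  q≢c i = proj₂ (proj₂ (in-petal i))
  q-injective : Injective _≡_ _≡_ q
  q-injective {i} {j} qi≡qj = same-petal (q∈E i) (subst (_∈ E j) (sym qi≡qj) (q∈E j)) (q≢c i)
  -- The centre if it lies in A, and otherwise a second vertex of A in the first petal.
  extra : ∃ λ w → w ∈ A × ∀ i → w ≢ q i
  extra with c ∈? A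
  ... | yes c∈A = c , c∈A , λ i c≡qi → q≢c i (sym c≡qi)
  ... | no  c∉A =
    let y , y∈E0∩A , y≢q0 = ∈-avoiding (meets zero) (q zero)
        y∈E0 , y∈A = x∈p∩q⁻ (E zero) A y∈E0∩A
        y≢c : y ≢ c
        y≢c y≡c = c∉A (subst (_∈ A) y≡c y∈A)
    in y , y∈A , λ i y≡qi →
         y≢q0 (subst (λ j → y ≡ q j) (sym (same-petal y∈E0 (subst (_∈ E i) (sym y≡qi) (q∈E i)) y≢c)) y≡qi)

-- The lower-bound construction

firstVertices : ∀ t m → Subset (t + m)
firstVertices zero    m = ⊥
firstVertices (suc t) m = inside ∷ firstVertices t m

∣firstVertices∣≡t : ∀ t m → ∣ firstVertices t m ∣ ≡ t
∣firstVertices∣≡t zero    m = ∣⊥∣≡0 m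
∣firstVertices∣≡t (suc t) m = cong suc (∣firstVertices∣≡t t m)

meetsTwice : ∀ r t m → RGraph r (t + m)
meetsTwice r t m = record
  { edge    = λ e → (∣ e ∣ ≡ᵇ r) ∧ (2 ≤ᵇ ∣ e ∩ firstVertices t m ∣)
  ; uniform = λ e eH → ≡ᵇ⇒≡ ∣ e ∣ r (proj₁ (Equivalence.to T-∧ (Equivalence.from T-≡ eH)))
  }

meetsTwice-free : ∀ {r t m ℓ} → t ≤ suc ℓ → StarExpFree (suc ℓ) (meetsTwice r t m)
meetsTwice-free {r} {t} {m} {ℓ} t≤1+ℓ (f , f-injective , edges) =
  ≤⇒≯ t≤1+ℓ (subst (2 + ℓ ≤_) (∣firstVertices∣≡t t m)
                    (star-meeting-twice {r = r} (firstVertices t m) f f-injective meets))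
  where
  meets : ∀ i → 2 ≤ ∣ starEdgeImage {suc ℓ} {r} f i ∩ firstVertices t m ∣
  meets i = ≤ᵇ⇒≤ 2 _ (proj₂ (Equivalence.to T-∧ (Equivalence.from T-≡ (edges i))))

⊇firstVertices⇒clique : ∀ {k t m S} → firstVertices t m ⊆ S → ∣ S ∣ ≡ t + k →
  Clique (meetsTwice (2 + k) t m) S
⊇firstVertices⇒clique {k} {t} {m} {S} F⊆S ∣S∣≡t+k e e⊆S ∣e∣≡2+k =
  Equivalence.to T-≡ (Equivalence.from T-∧ (≡⇒≡ᵇ _ _ ∣e∣≡2+k , ≤⇒≤ᵇ 2≤∣e∩F∣))
  where
  F = firstVertices t m
  ∣S─F∣≤k : ∣ S ─ F ∣ ≤ k
  ∣S─F∣≤k = +-cancelˡ-≤ t _ _ (begin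
    t + ∣ S ─ F ∣              ≡⟨ cong (_+ ∣ S ─ F ∣) (∣firstVertices∣≡t t m) ⟨
    ∣ F ∣ + ∣ S ─ F ∣          ≤⟨ +-monoˡ-≤ _ (p⊆q⇒∣p∣≤∣q∣ (λ x∈F → x∈p∩q⁺ (F⊆S x∈F , x∈F))) ⟩
    ∣ S ∩ F ∣ + ∣ S ─ F ∣      ≡⟨ ∣p∣≡∣p∩q∣+∣p─q∣ S F ⟨
    ∣ S ∣                      ≡⟨ ∣S∣≡t+k ⟩
    t + k                      ∎)
    where open ≤-Reasoning
  e─F⊆S─F : e ─ F ⊆ S ─ F
  e─F⊆S─F x∈e─F = x∈p∧x∉q⇒x∈p─q (e⊆S (p─q⊆p e F x∈e─F)) (x∈p─q⇒x∉q x∈e─F)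
  2≤∣e∩F∣ : 2 ≤ ∣ e ∩ F ∣
  2≤∣e∩F∣ = +-cancelʳ-≤ k 2 _ (begin
    2 + k                      ≡⟨ ∣e∣≡2+k ⟨
    ∣ e ∣                      ≡⟨ ∣p∣≡∣p∩q∣+∣p─q∣ e F ⟩
    ∣ e ∩ F ∣ + ∣ e ─ F ∣      ≤⟨ +-monoʳ-≤ _ (≤-trans (p⊆q⇒∣p∣≤∣q∣ e─F⊆S─F) ∣S─F∣≤k) ⟩
    ∣ e ∩ F ∣ + k              ∎)
    where open ≤-Reasoning

mCk≤#supersets : ∀ t m k → m C k ≤ countSubsets (t + m) (λ S → (firstVertices t m ⊆ᵇ S) ∧ (∣ S ∣ ≡ᵇ t + k))
mCk≤#supersets zero m k = begin
  m C k                                          ≡⟨ countSubsets-size m k ⟨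
  countSubsets m (λ S → ∣ S ∣ ≡ᵇ k)
    ≤⟨ countᵇ-mono _ _ (λ S h → Equivalence.from T-∧ (⊆⇒⊆ᵇ {X = ⊥} {S} ⊥⊆ , h)) (allSubsets m) ⟩
  countSubsets m (λ S → (⊥ ⊆ᵇ S) ∧ (∣ S ∣ ≡ᵇ k)) ∎
  where open ≤-Reasoning
mCk≤#supersets (suc t) m k = begin
  m C k                  ≤⟨ mCk≤#supersets t m k ⟩
  countSubsets (t + m) _ ≤⟨ m≤n+m _ _ ⟩
  _                      ≡⟨ countSubsets-suc (t + m) _ ⟨
  countSubsets (suc t + m) (λ S → (firstVertices (suc t) m ⊆ᵇ S) ∧ (∣ S ∣ ≡ᵇ suc t + k)) ∎
  where open ≤-Reasoning

mCk≤#Ks : ∀ t m k → m C k ≤ #Ks (t + k) (meetsTwice (2 + k) t m)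
mCk≤#Ks t m k = ≤-trans (mCk≤#supersets t m k) (countᵇ-mono _ _ superset⇒clique (allSubsets (t + m)))
  where
  superset⇒clique : ∀ S → T ((firstVertices t m ⊆ᵇ S) ∧ (∣ S ∣ ≡ᵇ t + k)) →
    T (isKsᵇ (t + k) (meetsTwice (2 + k) t m) S)
  superset⇒clique S h =
    let F⊆ᵇS , ∣S∣≡ᵇt+k = Equivalence.to T-∧ h
        ∣S∣≡t+k = ≡ᵇ⇒≡ ∣ S ∣ (t + k) ∣S∣≡ᵇt+k
    in Equivalence.from (isKsᵇ⇔Clique (t + k) (meetsTwice (2 + k) t m) S)
         (∣S∣≡t+k , ⊇firstVertices⇒clique (⊆ᵇ⇒⊆ F⊆ᵇS) ∣S∣≡t+k)

[m*n]^k≡m^k*n^k : ∀ m n k → (m * n) ^ k ≡ m ^ k * n ^ k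
[m*n]^k≡m^k*n^k m n zero    = refl
[m*n]^k≡m^k*n^k m n (suc k) =
  trans (cong (m * n *_) ([m*n]^k≡m^k*n^k m n k)) (*-interchange m n (m ^ k) (n ^ k))

power≤binomial : ∀ t k m .{{_ : NonZero k}} → (t + k) * k ≤ m → (t + m) ^ k ≤ suc k ^ k * (m C k)
power≤binomial t k m big = begin
  (t + m) ^ k            ≤⟨ ^-monoˡ-≤ k t+m≤[1+k]q ⟩
  (suc k * q) ^ k        ≡⟨ [m*n]^k≡m^k*n^k (suc k) q k ⟩
  suc k ^ k * q ^ k      ≤⟨ *-monoʳ-≤ (suc k ^ k) q^k≤mCk ⟩
  suc k ^ k * (m C k)    ∎
  where
  open ≤-Reasoning
  q : ℕ
  q = m / k
  kq≤m : k * q ≤ m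
  kq≤m = subst (_≤ m) (*-comm q k) (m/n*n≤m m k)
  q^k≤mCk : q ^ k ≤ m C k
  q^k≤mCk = ≤-trans (q^k≤[k*q]Ck q k)
    (subst (λ x → (k * q) C k ≤ x C k) (m∸n+n≡m kq≤m) (nCk≤[d+n]Ck (m ∸ k * q) (k * q) k))
  t+k≤q : t + k ≤ q
  t+k≤q = subst (_≤ q) (m*n/n≡m (t + k) k) (/-monoˡ-≤ k big)
  m≤k+q*k : m ≤ k + q * k
  m≤k+q*k = ≤-trans (≤-reflexive (m≡m%n+[m/n]*n m k)) (+-monoˡ-≤ (q * k) (<⇒≤ (m%n<n m k)))
  t+m≤[1+k]q : t + m ≤ suc k * q
  t+m≤[1+k]q = begin
    t + m                ≤⟨ +-monoʳ-≤ t m≤k+q*k ⟩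
    t + (k + q * k)      ≡⟨ +-assoc t k (q * k) ⟨
    t + k + q * k        ≤⟨ +-monoˡ-≤ (q * k) t+k≤q ⟩
    q + q * k            ≡⟨ *-suc q k ⟨
    q * suc k            ≡⟨ *-comm q (suc k) ⟩
    suc k * q            ∎

starExpFree⇒#Ks≤c*n^[r∸2] : ∀ {s r ℓ n} (H : RGraph r n) → 3 ≤ r → r ≤ s → StarExpFree ℓ H →
  #Ks s H ≤ 2 ^ ((r ∸ 2) * suc (ℓ * r) * suc (ℓ * r) * suc (ℓ * r)) * n ^ (r ∸ 2)
starExpFree⇒#Ks≤c*n^[r∸2] {r = r} {ℓ} H 3≤r r≤s free =
  #Ks≤c*n^[r∸2] (λ v → proj₁ (proj₂ (transversal v))) 3≤r r≤s
  where
  transversal : ∀ v → ∃ λ U → ∣ U ∣ ≤ ℓ * r × LinkTransversal H v U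
  transversal = link-transversals H free
  open Generation H (λ v → proj₁ (transversal v)) (λ v → proj₂ (proj₂ (transversal v)))

starExpFree-with-n^k≤d*#Ks : ∀ {t k ℓ} .{{_ : NonZero k}} → t ≤ suc ℓ → ∀ n → t + (t + k) * k ≤ n →
  Σ (RGraph (2 + k) n) λ H → StarExpFree (suc ℓ) H × n ^ k ≤ suc k ^ k * #Ks (t + k) H
starExpFree-with-n^k≤d*#Ks {t} {k} {ℓ} t≤1+ℓ n big =
  subst Witness (m+[n∸m]≡n t≤n) (meetsTwice (2 + k) t m , meetsTwice-free t≤1+ℓ , bound)
  where
  Witness : ℕ → Set
  Witness n = Σ (RGraph (2 + k) n) λ H → StarExpFree (suc ℓ) H × n ^ k ≤ suc k ^ k * #Ks (t + k) H
  t≤n : t ≤ n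
  t≤n = ≤-trans (m≤m+n t _) big
  m : ℕ
  m = n ∸ t
  bound : (t + m) ^ k ≤ suc k ^ k * #Ks (t + k) (meetsTwice (2 + k) t m)
  bound = ≤-trans (power≤binomial t k m (subst (_≤ m) (m+n∸m≡n t _) (∸-monoˡ-≤ t big)))
                  (*-monoʳ-≤ (suc k ^ k) (mCk≤#Ks t m k))

theorem2p5 : (s r ℓ : ℕ) → 3 ≤ r → r ≤ s → 2 ≤ ℓ →
    (∃ λ (c : ℕ) → ∃ λ (N : ℕ) → ∀ n → N ≤ n →
       (H : RGraph r n) → StarExpFree ℓ H → #Ks s H ≤ c * n ^ (r ∸ 2))
    × (s ≤ ℓ + r ∸ 2 →
       ∃ λ (d : ℕ) → 1 ≤ d × (∃ λ (N : ℕ) → ∀ n → N ≤ n →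
         Σ (RGraph r n) λ H → StarExpFree ℓ H × n ^ (r ∸ 2) ≤ d * #Ks s H))
theorem2p5 s r ℓ 3≤r@(s≤s (s≤s (s≤s {n = k′} _))) r≤s (s≤s _) =
  (c , 0 , λ n _ H → starExpFree⇒#Ks≤c*n^[r∸2] H 3≤r r≤s) ,
  λ s≤ℓ+r∸2 → suc k ^ k , m^n>0 (suc k) k , t + (t + k) * k , λ n big →
    subst (λ s → Σ (RGraph r n) λ H → StarExpFree ℓ H × n ^ k ≤ suc k ^ k * #Ks s H)
          (m∸n+n≡m k≤s) (starExpFree-with-n^k≤d*#Ks (t≤ℓ s≤ℓ+r∸2) n big)
  where
  -- The patterns expose r = 3 + k′ and ℓ = 1 + _, so that r ∸ 2 computes to k and the
  -- construction's RGraph (2 + k) n and StarExpFree (suc _) are those of the statement.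
  c k t : ℕ
  c = 2 ^ (k * suc (ℓ * r) * suc (ℓ * r) * suc (ℓ * r))
  k = suc k′
  t = s ∸ k
  k≤s : k ≤ s
  k≤s = ≤-trans (m∸n≤m r 2) r≤s
  t≤ℓ : s ≤ ℓ + r ∸ 2 → t ≤ ℓ
  t≤ℓ s≤ℓ+r∸2 = begin
    s ∸ k            ≤⟨ ∸-monoˡ-≤ k s≤ℓ+r∸2 ⟩
    ℓ + r ∸ 2 ∸ k    ≡⟨ cong (_∸ k) (+-∸-assoc ℓ (m≤m+n 2 k)) ⟩
    ℓ + k ∸ k        ≡⟨ m+n∸n≡m ℓ k ⟩
    ℓ                ∎
    where open ≤-Reasoning
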